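{- Let $\mathcal{P}$ be an autonomous poset and let $k$ be a minimal element of $\mathcal{P}$. Then $\mathcal{P}-k$ is an autonomous poset. Furthermore, if $G$ is a full-rank OSP-graph with $\mathfrak{S}(G)=\{\mathcal{P}\}$, then $\mathfrak{S}(G-k)=\{\mathcal{P}-k\}$, where $G-k$ is the induced subgraph of $G$ on $V(G)\setminus\{k\}$.
   Context: A simple pseudo-graph is a finite graph that may have loops but no multiple edges; its edge set $E(G)\subseteq V(G)\times V(G)$ is a symmetric relation, and $v$ is looped iff $vv\in E(G)$. Write $N(v)=\{w: vw\in E(G)\}$. An OSP-graph is a simple pseudo-graph whose vertex set is a finite set of positive integers with the usual order. Pressing a looped vertex $v$ produces $G_{(v)}$ with vertex set $V(G)$ and edge set $E(G)\,\triangle\,(N(v)\times N(v))$; $G_{(v_1,\dots,v_k)}$ denotes successive pressing. A successful pressing sequence is a sequence $(v_1,\dots,v_k)$ with each $v_i$ looped in $G_{(v_1,\dots,v_{i-1})}$ and $G_{(v_1,\dots,v_k)}$ having no edges and no loops; $\Sigma(G)$ is their set. $G$ is full-rank if its adjacency matrix (diagonal entry $1$ at looped vertices) is invertible over $\mathbb{F}_2$. For full-rank $G$ on $n$ vertices and $\sigma=(v_1,\dots,v_n)\in\Sigma(G)$, let $U$ be the upper-triangular $0/1$ matrix with $U[i,j]=1$ iff $i\le j$ and $v_iv_j\in E(G_{(v_1,\dots,v_{i-1})})$, $D$ the digraph on $V(G)$ with arc $v_i\to v_j$ whenever $U[i,j]=1$, and $\mathcal{P}(G,\sigma)=(V(G),\preceq)$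 the instructional poset with $y\preceq x$ iff there is a directed path (possibly of length $0$) from $x$ to $y$ in $D$. $\mathfrak{S}(G)=\{\mathcal{P}(G,\sigma):\sigma\in\Sigma(G)\}$. A linear extension of a poset is a listing $(\tau_1,\dots,\tau_n)$ of its elements with $\tau_i\succ\tau_j\Rightarrow i<j$; $\mathrm{LinExt}(\mathcal{P})$ is their set. A finite poset $\mathcal{P}$ is autonomous if there exist a full-rank OSP-graph $G$ and $\sigma\in\Sigma(G)$ with $\mathcal{P}(G,\sigma)$ isomorphic to $\mathcal{P}$ and $\Sigma(G)=\mathrm{LinExt}(\mathcal{P}(G,\sigma))$ (equivalently, $\mathfrak{S}(G)$ consists of a single poset, isomorphic to $\mathcal{P}$). $\mathcal{P}-k$ denotes the subposet on the remaining elements. -}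

module Defs where

open import Data.Nat using (ℕ; _≤_; _≟_; _≡ᵇ_)
open import Data.Nat.Properties using (≡⇒≡ᵇ)
open import Data.Bool using (Bool; true; false; _∧_; _xor_; not; T)
open import Data.Bool.Properties using (∧-comm)
open import Data.Fin using (Fin)
import Data.Fin as F
open import Data.List using (List; []; _∷_; _++_; filter; length; lookup; map; foldr; allFin)
open import Data.List.Membership.Propositional using (_∈_)
open import Data.List.Membership.Propositional.Properties using (∈-filter⁺; ∈-filter⁻)
open import Data.List.Relation.Unary.All using (All)
import Data.List.Relation.Unary.All.Properties as AllP
open import Data.List.Relation.Unary.Unique.Propositional using (Unique)
import Data.List.Relation.Unary.Unique.Propositional.Properties as UniqP
open import Data.List.Relation.Binary.Permutation.Propositional using (_↭_)
open import Data.Product using (Σ; ∃; _×_; _,_; proj₁; proj₂)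
open import Data.Sum using (_⊎_)
open import Data.Empty using (⊥)
open import Relation.Nullary using (¬_; ¬?; does; yes; no)
open import Relation.Nullary.Decidable using (⌊_⌋)
open import Relation.Binary.PropositionalEquality using (_≡_; _≢_; refl; sym; trans; cong; subst)
open import Relation.Binary.Construct.Closure.ReflexiveTransitive using (Star)

Rel : Set₁
Rel = ℕ → ℕ → Set

_⇔_ : Set → Set → Set
A ⇔ B = (A → B) × (B → A)

infix 2 _⇔_

-- Finite posets, represented on a finite set of natural numbers
-- (every finite poset is isomorphic to one of these).

record FinPoset : Set₁ where
  field
    elems    : List ℕ
    distinct : Unique elems
    _≼_      : ℕ → ℕ → Set
    ≼-refl   : ∀ {x} → x ∈ elems → x ≼ x
    ≼-antisym : ∀ {x y} → x ∈ elems → y ∈ elems → x ≼ y → y ≼ x → x ≡ y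
    ≼-trans  : ∀ {x y z} → x ∈ elems → y ∈ elems → z ∈ elems →
               x ≼ y → y ≼ z → x ≼ z

open FinPoset public

remove : ℕ → List ℕ → List ℕ
remove k xs = filter (λ x → ¬? (x ≟ k)) xs

∈-remove⁻ : ∀ {k x xs} → x ∈ remove k xs → x ∈ xs
∈-remove⁻ {k} p = proj₁ (∈-filter⁻ (λ x → ¬? (x ≟ k)) p)

Minimal : FinPoset → ℕ → Set
Minimal P k = k ∈ elems P × (∀ y → y ∈ elems P → _≼_ P y k → y ≡ k)

_-ᴾ_ : FinPoset → ℕ → FinPoset
P -ᴾ k = record
  { elems = remove k (elems P)
  ; distinct = UniqP.filter⁺ (λ x → ¬? (x ≟ k)) (distinct P)
  ; _≼_ = _≼_ P
  ; ≼-refl = λ x∈ → ≼-refl P (∈-remove⁻ x∈)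
  ; ≼-antisym = λ x∈ y∈ → ≼-antisym P (∈-remove⁻ x∈) (∈-remove⁻ y∈)
  ; ≼-trans = λ x∈ y∈ z∈ → ≼-trans P (∈-remove⁻ x∈) (∈-remove⁻ y∈) (∈-remove⁻ z∈)
  }

record OrderIso (xs : List ℕ) (R : Rel) (ys : List ℕ) (S : Rel) : Set where
  field
    f    : ℕ → ℕ
    maps : ∀ {x} → x ∈ xs → f x ∈ ys
    inj  : ∀ {x y} → x ∈ xs → y ∈ xs → f x ≡ f y → x ≡ y
    surj : ∀ {y} → y ∈ ys → ∃ λ x → x ∈ xs × f x ≡ y
    pres : ∀ {x y} → x ∈ xs → y ∈ xs → R x y ⇔ S (f x) (f y)

-- linear extensions of (xs , ≼): listings τ of xs such that
-- τ_i ≻ τ_j implies i < j, i.e. no later entry is strictly above an earlier one.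
LinExt : List ℕ → Rel → List ℕ → Set
LinExt xs _≼_ τ =
  (τ ↭ xs) ×
  (∀ pre x post → τ ≡ pre ++ x ∷ post → ∀ y → y ∈ pre → ¬ (y ≼ x × y ≢ x))

-- OSP-graphs: finite simple pseudo-graphs on a finite set of positive
-- integers.  The (symmetric) edge relation is given by its characteristic
-- function; vv is an edge iff v is looped.

EdgeFn : Set
EdgeFn = ℕ → ℕ → Bool

record OSPGraph : Set where
  field
    V        : List ℕ
    distinct : Unique V
    positive : All (λ v → 1 ≤ v) V
    E        : EdgeFn
    E-sym    : ∀ u w → E u w ≡ E w u
    E-inV    : ∀ u w → E u w ≡ true → u ∈ V

open OSPGraph public

private
  keep : ℕ → ℕ → Bool
  keep k x = not (x ≡ᵇ k)

  ≡ᵇ-false : ∀ {u k} → (u ≡ᵇ k) ≡ false → u ≢ k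
  ≡ᵇ-false {u} e refl = subst T e (≡⇒≡ᵇ u u refl)

  del-sym : ∀ (E : EdgeFn) → (∀ u w → E u w ≡ E w u) → ∀ k u w →
            (keep k u ∧ keep k w) ∧ E u w ≡ (keep k w ∧ keep k u) ∧ E w u
  del-sym E s k u w rewrite ∧-comm (keep k u) (keep k w) | s u w = refl

  del-inV : ∀ (G : OSPGraph) k u w → (keep k u ∧ keep k w) ∧ E G u w ≡ true →
            u ∈ remove k (V G)
  del-inV G k u w with u ≡ᵇ k in eu | w ≡ᵇ k | E G u w in e
  ... | true  | _     | _     = λ ()
  ... | false | true  | _     = λ ()
  ... | false | false | false = λ ()
  ... | false | false | true  = λ _ → ∈-filter⁺ (λ x → ¬? (x ≟ k)) (E-inV G u w e) (≡ᵇ-false eu)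

_-ᴳ_ : OSPGraph → ℕ → OSPGraph
G -ᴳ k = record
  { V = remove k (V G)
  ; distinct = UniqP.filter⁺ (λ x → ¬? (x ≟ k)) (distinct G)
  ; positive = AllP.filter⁺ (λ x → ¬? (x ≟ k)) (positive G)
  ; E = λ u w → (keep k u ∧ keep k w) ∧ E G u w
  ; E-sym = del-sym (E G) (E-sym G) k
  ; E-inV = del-inV G k
  }

-- Full rank: the adjacency matrix is invertible over 𝔽₂ (Bool with xor, ∧)

Matrix : ℕ → Set
Matrix n = Fin n → Fin n → Bool

_·_ : ∀ {n} → Matrix n → Matrix n → Matrix n
_·_ {n} A B i j = foldr _xor_ false (map (λ l → A i l ∧ B l j) (allFin n))

identity : ∀ {n} → Matrix n
identity i j = ⌊ i F.≟ j ⌋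

adjacency : (G : OSPGraph) → Matrix (length (V G))
adjacency G i j = E G (lookup (V G) i) (lookup (V G) j)

FullRank : OSPGraph → Set
FullRank G = Σ (Matrix (length (V G))) λ B →
  (∀ i j → (adjacency G · B) i j ≡ identity i j) ×
  (∀ i j → (B · adjacency G) i j ≡ identity i j)

-- E(G_(v)) = E(G) △ (N(v) × N(v))
press : EdgeFn → ℕ → EdgeFn
press E v u w = E u w xor (E v u ∧ E v w)

Successful : EdgeFn → List ℕ → Set
Successful E []      = ∀ u w → E u w ≡ false
Successful E (v ∷ σ) = (E v v ≡ true) × Successful (press E v) σ

InΣ : OSPGraph → List ℕ → Set
InΣ G σ = Successful (E G) σ

-- Arc E σ x y : arc x → y of D, i.e. x = v_i, y = v_j with i ≤ j and
-- v_i v_j an edge of E_(v_1 … v_{i-1}).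
Arc : EdgeFn → List ℕ → Rel
Arc E []      x y = ⊥
Arc E (v ∷ σ) x y = (x ≡ v × y ∈ (v ∷ σ) × E v y ≡ true) ⊎ Arc (press E v) σ x y

-- InstrLE G σ y x  means  y ⪯ x in P(G,σ): directed path from x to y in D
InstrLE : OSPGraph → List ℕ → Rel
InstrLE G σ y x = Star (Arc (E G) σ) x y

Autonomous : FinPoset → Set
Autonomous P = Σ OSPGraph λ G → FullRank G × Σ (List ℕ) λ σ →
  InΣ G σ ×
  OrderIso (V G) (InstrLE G σ) (elems P) (_≼_ P) ×
  (∀ τ → InΣ G τ ⇔ LinExt (V G) (InstrLE G σ) τ)

-- 𝔖(G) = {P}, for a poset P on V(G): Σ(G) is nonempty and every
-- σ ∈ Σ(G) gives exactly P.
SinglePoset : OSPGraph → FinPoset → Set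
SinglePoset G P =
  (∀ x → x ∈ elems P ⇔ x ∈ V G) ×
  (Σ (List ℕ) λ σ → InΣ G σ) ×
  (∀ σ → InΣ G σ → ∀ x y → x ∈ V G → y ∈ V G → _≼_ P x y ⇔ InstrLE G σ x y)

-- Pressing a looped vertex v is a step of symmetric Gaussian elimination over 𝔽₂: on the
-- unpressed vertices the remaining matrix is still inverted by the restriction of the inverse
-- B of the adjacency matrix.  Hence a successful sequence of a full-rank graph presses every
-- vertex.  If k is minimal in P(G, σ), then k has no neighbour but itself when σ presses it,
-- so pressing k merely erases its loop: σ without k is a successful sequence of G − k with
-- the same instructional order away from k.  G − k has full rank, its inverse being the Schur
-- complement of B at the pivot B k k, which is 1 because k is isolated when pressed.  So every
-- τ ∈ Σ(G − k) presses all vertices but k, after which only the loop at k is left in G; thus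
-- τ k ∈ Σ(G), again with the same order away from k.  Transporting Σ(G) = LinExt(P) and
-- 𝔖(G) = {P} along these correspondences gives both statements.

{-# OPTIONS --safe #-}
module Submission where

open import Defs
open import Data.Bool using (Bool; true; false; _∧_; _xor_; not)
open import Data.Bool.Properties
  using (∧-comm; ∧-assoc; ∧-zeroʳ; ∧-identityʳ; xor-assoc; xor-comm; xor-same; xor-identityʳ; ∧-distribˡ-xor; ∧-distribʳ-xor; xor-∧-commutativeRing)
open import Data.Empty using (⊥-elim)
open import Data.Unit using (⊤; tt)
import Data.Fin as Fin
open import Data.List using (List; []; _∷_; _++_; [_]; length; lookup; map; foldr; allFin; tabulate; initLast; _∷ʳ′_)
open import Data.List.Properties
  using (map-∘; map-tabulate; tabulate-lookup; filter-accept; filter-reject; filter-all; ++-identityʳ; ++-assoc; ∷ʳ-injective; ∷ʳ-injectiveˡ)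
open import Data.List.Membership.Propositional using (_∈_; _∉_)
open import Data.List.Membership.Propositional.Properties using (∈-filter⁺; ∈-filter⁻; ∈-++⁺ˡ; ∈-++⁺ʳ; ∈-++⁻; ∈-∃++; ∈-lookup)
open import Data.List.Relation.Unary.All as All using (All; []; _∷_)
open import Data.List.Relation.Unary.AllPairs using ([]; _∷_)
open import Data.List.Relation.Unary.Any as Any using (here; there)
open import Data.List.Relation.Unary.Any.Properties using (lookup-index)
open import Data.List.Relation.Unary.Unique.Propositional using (Unique)
open import Data.List.Relation.Binary.Permutation.Propositional using (_↭_; refl; prep; swap; trans; ↭-refl; ↭-sym; ↭-trans; ↭-prep; ↭-swap)
import Data.List.Relation.Binary.Permutation.Propositional.Properties as ↭
import Data.List.Relation.Unary.Unique.Propositional.Properties as UniqP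
import Data.List.Relation.Unary.All.Properties as AllP
open import Data.Nat using (ℕ; _≟_)
open import Data.List.Membership.DecPropositional _≟_ using (_∈?_)
open import Data.Product using (Σ; ∃; _×_; _,_; proj₁; proj₂)
open import Data.Sum using (_⊎_; inj₁; inj₂)
open import Function using (_∘_; case_of_)
open import Relation.Nullary using (¬_; ¬?; yes; no; does)
open import Relation.Nullary.Decidable using (dec-true; dec-false)
open import Relation.Binary.PropositionalEquality
  using (_≡_; _≢_; refl; sym; cong; cong₂; subst; subst₂; ≢-sym; module ≡-Reasoning)
  renaming (trans to ≡-trans)
open import Relation.Binary.Construct.Closure.ReflexiveTransitive as Star using (Star; ε; _◅_)
open import Algebra.Bundles using (CommutativeRing)
open import Algebra.Properties.CommutativeSemigroup
  (CommutativeRing.+-commutativeSemigroup xor-∧-commutativeRing) using () renaming (interchange to xor-interchange)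

private
  variable
    A : Set
    k u v w x y : ℕ
    W xs ys σ τ pre post : List ℕ

⇔-trans : ∀ {P Q R : Set} → P ⇔ Q → Q ⇔ R → P ⇔ R
⇔-trans (P→Q , Q→P) (Q→R , R→Q) = Q→R ∘ P→Q , Q→P ∘ R→Q

δ : ℕ → ℕ → Bool
δ a b = does (a ≟ b)

δ-refl : ∀ a → δ a a ≡ true
δ-refl a = dec-true (a ≟ a) refl

δ-≢ : ∀ {a b} → a ≢ b → δ a b ≡ false
δ-≢ {a} {b} = dec-false (a ≟ b)

xor-cancelˡ : ∀ a {b c} → a xor b ≡ c → b ≡ a xor c
xor-cancelˡ a {b} refl = begin
  b                   ≡⟨ cong (_xor b) (xor-same a) ⟨
  (a xor a) xor b     ≡⟨ xor-assoc a a b ⟩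
  a xor (a xor b)     ∎
  where open ≡-Reasoning

⨁ : List A → (A → Bool) → Bool
⨁ xs f = foldr _xor_ false (map f xs)

⨁-cong : ∀ xs {f g : A → Bool} → (∀ {x} → x ∈ xs → f x ≡ g x) → ⨁ xs f ≡ ⨁ xs g
⨁-cong []       eq = refl
⨁-cong (x ∷ xs) eq = cong₂ _xor_ (eq (here refl)) (⨁-cong xs (eq ∘ there))

⨁-↭ : ∀ {xs ys : List A} (f : A → Bool) → xs ↭ ys → ⨁ xs f ≡ ⨁ ys f
⨁-↭ f refl          = refl
⨁-↭ f (prep x p)    = cong (f x xor_) (⨁-↭ f p)
⨁-↭ f (swap {xs} {ys} x y p) = begin
  f x xor (f y xor ⨁ xs f)  ≡⟨ xor-assoc (f x) (f y) _ ⟨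
  (f x xor f y) xor ⨁ xs f  ≡⟨ cong₂ _xor_ (xor-comm (f x) (f y)) (⨁-↭ f p) ⟩
  (f y xor f x) xor ⨁ ys f  ≡⟨ xor-assoc (f y) (f x) _ ⟩
  f y xor (f x xor ⨁ ys f)  ∎
  where open ≡-Reasoning
⨁-↭ f (trans p q)   = ≡-trans (⨁-↭ f p) (⨁-↭ f q)

⨁-xor : ∀ xs (f g : A → Bool) → ⨁ xs (λ x → f x xor g x) ≡ ⨁ xs f xor ⨁ xs g
⨁-xor []       f g = refl
⨁-xor (x ∷ xs) f g =
  ≡-trans (cong ((f x xor g x) xor_) (⨁-xor xs f g)) (xor-interchange (f x) (g x) _ _)

⨁-∧ʳ : ∀ xs (f : A → Bool) c → ⨁ xs (λ x → f x ∧ c) ≡ ⨁ xs f ∧ c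
⨁-∧ʳ []       f c = refl
⨁-∧ʳ (x ∷ xs) f c = ≡-trans (cong ((f x ∧ c) xor_) (⨁-∧ʳ xs f c)) (sym (∧-distribʳ-xor c (f x) _))

⨁-∧ˡ : ∀ xs (f : A → Bool) c → ⨁ xs (λ x → c ∧ f x) ≡ c ∧ ⨁ xs f
⨁-∧ˡ []       f c = sym (∧-zeroʳ c)
⨁-∧ˡ (x ∷ xs) f c = ≡-trans (cong ((c ∧ f x) xor_) (⨁-∧ˡ xs f c)) (sym (∧-distribˡ-xor c (f x) _))

⨁-zero : ∀ xs {f : A → Bool} → (∀ {x} → x ∈ xs → f x ≡ false) → ⨁ xs f ≡ false
⨁-zero []       z = refl
⨁-zero (x ∷ xs) z rewrite z (here refl) = ⨁-zero xs (z ∘ there)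

⨁-lookup : ∀ xs (f : A → Bool) → ⨁ (allFin (length xs)) (f ∘ lookup xs) ≡ ⨁ xs f
⨁-lookup xs f = cong (foldr _xor_ false) (begin
  map (f ∘ lookup xs) (allFin (length xs))       ≡⟨ map-∘ (allFin (length xs)) ⟩
  map f (map (lookup xs) (allFin (length xs)))   ≡⟨ cong (map f) (map-tabulate (λ i → i) (lookup xs)) ⟩
  map f (tabulate (lookup xs))         ≡⟨ cong (map f) (tabulate-lookup xs) ⟩
  map f xs                                       ∎)
  where open ≡-Reasoning

∈-remove⁺ : x ∈ xs → x ≢ k → x ∈ remove k xs
∈-remove⁺ {k = k} = ∈-filter⁺ (λ x → ¬? (x ≟ k))

∈-remove-≢ : x ∈ remove k xs → x ≢ k
∈-remove-≢ {k = k} {xs = xs} x∈ = proj₂ (∈-filter⁻ (λ x → ¬? (x ≟ k)) {xs = xs} x∈)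

remove-↭ : Unique xs → k ∈ xs → xs ↭ k ∷ remove k xs
remove-↭ {x ∷ xs} {k} (x∉xs ∷ _) (here refl)
  rewrite filter-reject (λ y → ¬? (y ≟ k)) {xs = xs} (λ k≢k → k≢k refl)
        | filter-all (λ y → ¬? (y ≟ k)) (All.map ≢-sym x∉xs) = ↭-refl
remove-↭ {x ∷ xs} {k} (x∉xs ∷ u) (there k∈xs)
  rewrite filter-accept (λ y → ¬? (y ≟ k)) {xs = xs} (All.lookup x∉xs k∈xs) =
  ↭-trans (↭-prep x (remove-↭ u k∈xs)) (↭-swap x k ↭-refl)

removeAll : List ℕ → List ℕ → List ℕ
removeAll []      W = W
removeAll (v ∷ σ) W = removeAll σ (remove v W)

∈-removeAll⁺ : ∀ σ → w ∈ W → w ∉ σ → w ∈ removeAll σ W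
∈-removeAll⁺ []      w∈ w∉ = w∈
∈-removeAll⁺ (v ∷ σ) w∈ w∉ = ∈-removeAll⁺ σ (∈-remove⁺ w∈ (w∉ ∘ here)) (w∉ ∘ there)

∈-removeAll⁻ : ∀ σ → w ∈ removeAll σ W → w ∈ W × w ∉ σ
∈-removeAll⁻ {W = W} (v ∷ σ) w∈ with ∈-removeAll⁻ σ w∈
... | w∈W , w∉σ = ∈-remove⁻ {xs = W} w∈W ,
  λ { (here refl) → ∈-remove-≢ {xs = W} w∈W refl ; (there w∈σ) → w∉σ w∈σ }
∈-removeAll⁻ []      w∈ = w∈ , λ ()

infix 4 _≐_

_≐_ : EdgeFn → EdgeFn → Set
E ≐ F = ∀ u w → E u w ≡ F u w

IsSymmetric : EdgeFn → Set
IsSymmetric E = ∀ u w → E u w ≡ E w u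

Edgeless : EdgeFn → Set
Edgeless E = ∀ u w → E u w ≡ false

pressAll : EdgeFn → List ℕ → EdgeFn
pressAll E []      = E
pressAll E (v ∷ σ) = pressAll (press E v) σ

Pressable : EdgeFn → List ℕ → Set
Pressable E []      = ⊤
Pressable E (v ∷ σ) = (E v v ≡ true) × Pressable (press E v) σ

successful⇒pressable : ∀ σ {E} → Successful E σ → Pressable E σ
successful⇒pressable []      _        = tt
successful⇒pressable (v ∷ σ) (vv , s) = vv , successful⇒pressable σ s

successful⇒edgeless : ∀ σ {E} → Successful E σ → Edgeless (pressAll E σ)
successful⇒edgeless []      s       = s
successful⇒edgeless (v ∷ σ) (_ , s) = successful⇒edgeless σ s

successful-++⁻ : ∀ σ {ρ E} → Successful E (σ ++ ρ) → Pressable E σ × Successful (pressAll E σ) ρ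
successful-++⁻ []      s        = tt , s
successful-++⁻ (v ∷ σ) (vv , s) with successful-++⁻ σ s
... | p , s′ = (vv , p) , s′

press-cong : ∀ {E F} v → E ≐ F → press E v ≐ press F v
press-cong v E≐F u w rewrite E≐F u w | E≐F v u | E≐F v w = refl

successful-cong : ∀ σ {E F} → E ≐ F → Successful E σ → Successful F σ
successful-cong []      E≐F s        u w = ≡-trans (sym (E≐F u w)) (s u w)
successful-cong (v ∷ σ) E≐F (vv , s) = ≡-trans (sym (E≐F v v)) vv , successful-cong σ (press-cong v E≐F) s

pressable-cong : ∀ σ {E F} → E ≐ F → Pressable E σ → Pressable F σ
pressable-cong []      E≐F _        = tt
pressable-cong (v ∷ σ) E≐F (vv , p) = ≡-trans (sym (E≐F v v)) vv , pressable-cong σ (press-cong v E≐F) p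

arc-cong : ∀ σ {E F} → E ≐ F → Arc E σ x y → Arc F σ x y
arc-cong (v ∷ σ) E≐F (inj₁ (x≡v , y∈ , vy)) = inj₁ (x≡v , y∈ , ≡-trans (sym (E≐F v _)) vy)
arc-cong (v ∷ σ) E≐F (inj₂ a)               = inj₂ (arc-cong σ (press-cong v E≐F) a)

press-sym : ∀ {E} v → IsSymmetric E → IsSymmetric (press E v)
press-sym {E} v symm u w rewrite symm u w | ∧-comm (E v u) (E v w) = refl

pressAll-sym : ∀ σ {E} → IsSymmetric E → IsSymmetric (pressAll E σ)
pressAll-sym []      symm = symm
pressAll-sym (v ∷ σ) symm = pressAll-sym σ (press-sym v symm)

press-isolates : ∀ {E v} → E v v ≡ true → ∀ w → press E v v w ≡ false
press-isolates {E} {v} vv w rewrite vv = xor-same (E v w)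

press-preserves-isolated : ∀ {E} u → IsSymmetric E → (∀ w → E v w ≡ false) → ∀ w → press E u v w ≡ false
press-preserves-isolated {v} {E} u symm iso w rewrite symm u v | iso u | iso w = refl

isolated-fresh : ∀ σ {E} → IsSymmetric E → (∀ w → E v w ≡ false) → Pressable E σ → All (v ≢_) σ
isolated-fresh []      symm iso _        = []
isolated-fresh (u ∷ σ) symm iso (uu , p) =
  (λ { refl → case ≡-trans (sym (iso u)) uu of λ () })
  ∷ isolated-fresh σ (press-sym u symm) (press-preserves-isolated u symm iso) p

-- A pressed vertex is left without edges, so it is never looped again.
pressable-unique : ∀ σ {E} → IsSymmetric E → Pressable E σ → Unique σ
pressable-unique []      symm _        = []
pressable-unique (v ∷ σ) {E} symm (vv , p) =
  isolated-fresh σ (press-sym v symm) (press-isolates {E} vv) p ∷ pressable-unique σ (press-sym v symm) p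

unique-middle : ∀ pre → Unique (pre ++ k ∷ post) → All (_≢ k) (pre ++ post)
unique-middle []        (k∉ ∷ _)   = All.map ≢-sym k∉
unique-middle (v ∷ pre) (v∉ ∷ u) = All.lookup v∉ (∈-++⁺ʳ pre (here refl)) ∷ unique-middle pre u

arc-source : ∀ σ {E} → Arc E σ x y → x ∈ σ
arc-source (v ∷ σ) (inj₁ (refl , _)) = here refl
arc-source (v ∷ σ) (inj₂ a)          = there (arc-source σ a)

arc-++⁺ʳ : ∀ pre {ρ E} → Arc (pressAll E pre) ρ x y → Arc E (pre ++ ρ) x y
arc-++⁺ʳ []        a = a
arc-++⁺ʳ (v ∷ pre) a = inj₂ (arc-++⁺ʳ pre a)

-- Definitionally the edge function of G -ᴳ k, as does (u ≟ k) reduces to u ≡ᵇ k.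
delete : ℕ → EdgeFn → EdgeFn
delete k E u w = (not (δ u k) ∧ not (δ w k)) ∧ E u w

delete-≢ : ∀ E → u ≢ k → w ≢ k → delete k E u w ≡ E u w
delete-≢ E u≢k w≢k rewrite δ-≢ u≢k | δ-≢ w≢k = refl

delete-row : ∀ E w → delete k E k w ≡ false
delete-row {k} E w rewrite δ-refl k = refl

delete-col : ∀ E u → delete k E u k ≡ false
delete-col {k} E u rewrite δ-refl k | ∧-zeroʳ (not (δ u k)) = refl

delete-true : ∀ E → delete k E u w ≡ true → u ≢ k × w ≢ k × E u w ≡ true
delete-true {k} {u} {w} E uw with u ≟ k | w ≟ k
... | yes refl | _        = case ≡-trans (sym (delete-row E w)) uw of λ ()
... | no _     | yes refl = case ≡-trans (sym (delete-col E u)) uw of λ ()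
... | no u≢k   | no w≢k   = u≢k , w≢k , ≡-trans (sym (delete-≢ E u≢k w≢k)) uw

delete-sym : ∀ {E} → IsSymmetric E → IsSymmetric (delete k E)
delete-sym {k} {E} symm u w rewrite ∧-comm (not (δ u k)) (not (δ w k)) | symm u w = refl

press-delete : ∀ E → v ≢ k → press (delete k E) v ≐ delete k (press E v)
press-delete {v} {k} E v≢k u w rewrite δ-≢ v≢k with not (δ u k) | not (δ w k)
... | true  | true  = refl
... | true  | false = ∧-zeroʳ _
... | false | true  = refl
... | false | false = refl

pressable-delete⁻ : ∀ σ {E} → Pressable (delete k E) σ → Pressable E σ × All (_≢ k) σ
pressable-delete⁻ []      _        = tt , []
pressable-delete⁻ (v ∷ σ) {E} (vv , p) with delete-true E vv
... | v≢k , _ , vv′ with pressable-delete⁻ σ (pressable-cong σ (press-delete E v≢k) p)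
...   | p′ , others = (vv′ , p′) , v≢k ∷ others

-- Skipping a vertex whose only edge is its loop

≐-sym : ∀ {E F} → E ≐ F → F ≐ E
≐-sym E≐F u w = sym (E≐F u w)

record IsolatedLoop (E : EdgeFn) (k : ℕ) : Set where
  field
    loop : E k k ≡ true
    row  : ∀ w → w ≢ k → E k w ≡ false
    col  : ∀ u → u ≢ k → E u k ≡ false

press-isolatedLoop : ∀ {E} → IsolatedLoop E k → press E k ≐ delete k E
press-isolatedLoop {k} {E} record { loop = loop ; row = row ; col = col } u w with u ≟ k | w ≟ k
... | yes refl | yes refl rewrite delete-row {k} E k | loop = refl
... | yes refl | no w≢k   rewrite delete-row {k} E w | loop | row w w≢k = refl
... | no u≢k   | yes refl rewrite delete-col {k} E u | col u u≢k | row u u≢k = refl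
... | no u≢k   | no w≢k   rewrite row u u≢k | delete-≢ E u≢k w≢k = xor-identityʳ (E u w)

-- pre and post are the parts of a pressing sequence pre ++ k ∷ post.
IsolatedPress : EdgeFn → ℕ → List ℕ → List ℕ → Set
IsolatedPress E k pre post = All (_≢ k) (pre ++ post) × IsolatedLoop (pressAll E pre) k

∈-unskip : ∀ pre → y ∈ pre ++ post → y ∈ pre ++ k ∷ post
∈-unskip pre y∈ with ∈-++⁻ pre y∈
... | inj₁ y∈pre  = ∈-++⁺ˡ y∈pre
... | inj₂ y∈post = ∈-++⁺ʳ pre (there y∈post)

∈-skip : ∀ pre → y ≢ k → y ∈ pre ++ k ∷ post → y ∈ pre ++ post
∈-skip pre y≢k y∈ with ∈-++⁻ pre y∈
... | inj₁ y∈pre          = ∈-++⁺ˡ y∈pre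
... | inj₂ (here refl)    = ⊥-elim (y≢k refl)
... | inj₂ (there y∈post) = ∈-++⁺ʳ pre y∈post

successful-skip : ∀ pre {E} → IsolatedPress E k pre post →
  Successful E (pre ++ k ∷ post) ⇔ Successful (delete k E) (pre ++ post)
successful-skip {post = post} [] (_ , iso) =
  (λ (_ , s) → successful-cong post (press-isolatedLoop iso) s) ,
  (λ s → IsolatedLoop.loop iso , successful-cong post (≐-sym (press-isolatedLoop iso)) s)
successful-skip {post = post} (v ∷ pre) {E} (v≢k ∷ others , iso) =
  (λ (vv , s) → ≡-trans (delete-≢ E v≢k v≢k) vv ,
                successful-cong (pre ++ post) (≐-sym (press-delete E v≢k)) (proj₁ IH s)) ,
  (λ (vv , s) → ≡-trans (sym (delete-≢ E v≢k v≢k)) vv ,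
                proj₂ IH (successful-cong (pre ++ post) (press-delete E v≢k) s))
  where IH = successful-skip pre (others , iso)

arc-unskip : ∀ pre {E} → IsolatedPress E k pre post →
  Arc (delete k E) (pre ++ post) x y → Arc E (pre ++ k ∷ post) x y
arc-unskip {post = post} [] (_ , iso) a = inj₂ (arc-cong post (≐-sym (press-isolatedLoop iso)) a)
arc-unskip (v ∷ pre) {E} (v≢k ∷ others , iso) (inj₁ (x≡v , y∈ , vy)) =
  inj₁ (x≡v , ∈-unskip (v ∷ pre) y∈ , proj₂ (proj₂ (delete-true E vy)))
arc-unskip (v ∷ pre) {E} (v≢k ∷ others , iso) (inj₂ a) =
  inj₂ (arc-unskip pre (others , iso) (arc-cong _ (press-delete E v≢k) a))

arc-skip : ∀ pre {E} → IsolatedPress E k pre post → y ≢ k →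
  Arc E (pre ++ k ∷ post) x y → Arc (delete k E) (pre ++ post) x y
arc-skip [] (_ , iso) y≢k (inj₁ (_ , _ , ky)) = case ≡-trans (sym (IsolatedLoop.row iso _ y≢k)) ky of λ ()
arc-skip {post = post} [] (_ , iso) y≢k (inj₂ a) = arc-cong post (press-isolatedLoop iso) a
arc-skip (v ∷ pre) {E} (v≢k ∷ others , iso) y≢k (inj₁ (x≡v , y∈ , vy)) =
  inj₁ (x≡v , ∈-skip (v ∷ pre) y≢k y∈ , ≡-trans (delete-≢ E v≢k y≢k) vy)
arc-skip (v ∷ pre) {E} (v≢k ∷ others , iso) y≢k (inj₂ a) =
  inj₂ (arc-cong _ (≐-sym (press-delete E v≢k)) (arc-skip pre (others , iso) y≢k a))

arc-from-skipped : ∀ pre {E} → IsolatedPress E k pre post → Arc E (pre ++ k ∷ post) k y → y ≡ k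
arc-from-skipped {k} {y = y} [] (_ , iso) (inj₁ (_ , _ , ky)) with y ≟ k
... | yes y≡k = y≡k
... | no  y≢k = case ≡-trans (sym (IsolatedLoop.row iso y y≢k)) ky of λ ()
arc-from-skipped {post = post} [] (others , _) (inj₂ a) = ⊥-elim (All.lookup others (arc-source post a) refl)
arc-from-skipped (v ∷ pre) (v≢k ∷ _ , _) (inj₁ (refl , _)) = ⊥-elim (v≢k refl)
arc-from-skipped (v ∷ pre) (_ ∷ others , iso) (inj₂ a) = arc-from-skipped pre (others , iso) a

star-from-skipped : ∀ pre {E} → IsolatedPress E k pre post → Star (Arc E (pre ++ k ∷ post)) k y → y ≡ k
star-from-skipped pre ip ε = refl
star-from-skipped pre ip (a ◅ as) with arc-from-skipped pre ip a
... | refl = star-from-skipped pre ip as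

star-unskip : ∀ pre {E} → IsolatedPress E k pre post →
  Star (Arc (delete k E) (pre ++ post)) x y → Star (Arc E (pre ++ k ∷ post)) x y
star-unskip pre ip = Star.map (arc-unskip pre ip)

star-skip : ∀ pre {E} → IsolatedPress E k pre post → y ≢ k →
  Star (Arc E (pre ++ k ∷ post)) x y → Star (Arc (delete k E) (pre ++ post)) x y
star-skip pre ip y≢k ε = ε
star-skip {k} pre ip y≢k (_◅_ {j = z} a as) with z ≟ k
... | yes refl = ⊥-elim (y≢k (star-from-skipped pre ip as))
... | no  z≢k  = arc-skip pre ip z≢k a ◅ star-skip pre ip y≢k as

-- Pressing and deleting as Gaussian elimination over 𝔽₂

∧-true : ∀ a {b} → a ∧ b ≡ true → a ≡ true × b ≡ true
∧-true true ab = refl , ab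

xor-∧-true : ∀ a b c → a xor (b ∧ c) ≡ true → a ≡ true ⊎ b ≡ true
xor-∧-true true  _     _ _  = inj₁ refl
xor-∧-true false true  _ _  = inj₂ refl
xor-∧-true false false _ ()

xor-absorb : ∀ c d → (c xor d) xor c ≡ d
xor-absorb c d = begin
  (c xor d) xor c  ≡⟨ cong (_xor c) (xor-comm c d) ⟩
  (d xor c) xor c  ≡⟨ xor-assoc d c c ⟩
  d xor (c xor c)  ≡⟨ cong (d xor_) (xor-same c) ⟩
  d xor false      ≡⟨ xor-identityʳ d ⟩
  d                ∎
  where open ≡-Reasoning

⨁-remove : ∀ {W} (f : ℕ → Bool) → Unique W → k ∈ W → ⨁ W f ≡ f k xor ⨁ (remove k W) f
⨁-remove f u k∈ = ⨁-↭ f (remove-↭ u k∈)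

RightInverseOn : EdgeFn → List ℕ → (ℕ → ℕ → Bool) → Set
RightInverseOn E W B = ∀ {i j} → i ∈ W → j ∈ W → ⨁ W (λ l → E i l ∧ B l j) ≡ δ i j

record NonsingularOn (E : EdgeFn) (W : List ℕ) (B : ℕ → ℕ → Bool) : Set where
  field
    unique    : Unique W
    symmetric : IsSymmetric E
    support   : ∀ u w → E u w ≡ true → u ∈ W
    inverse   : RightInverseOn E W B

rightInverseOn-remove : ∀ {E B i j} → Unique W → k ∈ W → RightInverseOn E W B → i ∈ W → j ∈ W →
  ⨁ (remove k W) (λ l → E i l ∧ B l j) ≡ (E i k ∧ B k j) xor δ i j
rightInverseOn-remove {k = k} {E = E} {B} {i} {j} u k∈ inv i∈ j∈ =
  xor-cancelˡ (E i k ∧ B k j) (≡-trans (sym (⨁-remove (λ l → E i l ∧ B l j) u k∈)) (inv i∈ j∈))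

-- Pressing v takes the Schur complement of E at the pivot E v v = 1, and the inverse of a Schur
-- complement is the corresponding block of the inverse.
press-nonsingularOn : ∀ {E B} → E v v ≡ true → NonsingularOn E W B → NonsingularOn (press E v) (remove v W) B
press-nonsingularOn {v} {W} {E} {B} vv N = record
  { unique    = UniqP.filter⁺ (λ x → ¬? (x ≟ v)) unique
  ; symmetric = press-sym v symmetric
  ; support   = support′
  ; inverse   = inverse′
  }
  where
  open NonsingularOn N
  v∈ = support v v vv
  support′ : ∀ u w → press E v u w ≡ true → u ∈ remove v W
  support′ u w uw with u ≟ v | xor-∧-true (E u w) (E v u) (E v w) uw
  ... | yes refl | _        = case ≡-trans (sym (press-isolates {E} vv w)) uw of λ ()
  ... | no u≢v   | inj₁ uw′ = ∈-remove⁺ (support u w uw′) u≢v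
  ... | no u≢v   | inj₂ vu  = ∈-remove⁺ (support u v (≡-trans (symmetric u v) vu)) u≢v
  inverse′ : RightInverseOn (press E v) (remove v W) B
  inverse′ {i} {j} i∈ j∈ = begin
    ⨁ W′ (λ l → press E v i l ∧ B l j)
      ≡⟨ ⨁-cong W′ (λ {l} _ → expand l) ⟩
    ⨁ W′ (λ l → (E i l ∧ B l j) xor (E v i ∧ (E v l ∧ B l j)))
      ≡⟨ ⨁-xor W′ (λ l → E i l ∧ B l j) (λ l → E v i ∧ (E v l ∧ B l j)) ⟩
    ⨁ W′ (λ l → E i l ∧ B l j) xor ⨁ W′ (λ l → E v i ∧ (E v l ∧ B l j))
      ≡⟨ cong (⨁ W′ (λ l → E i l ∧ B l j) xor_) (⨁-∧ˡ W′ (λ l → E v l ∧ B l j) (E v i)) ⟩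
    ⨁ W′ (λ l → E i l ∧ B l j) xor (E v i ∧ ⨁ W′ (λ l → E v l ∧ B l j))
      ≡⟨ cong₂ (λ s t → s xor (E v i ∧ t)) (rightInverseOn-remove {E = E} {B} unique v∈ inverse i∈W j∈W)
                                           (rightInverseOn-remove {E = E} {B} unique v∈ inverse v∈ j∈W) ⟩
    ((E i v ∧ B v j) xor δ i j) xor (E v i ∧ ((E v v ∧ B v j) xor δ v j))
      ≡⟨ cong₂ (λ a b → ((E i v ∧ B v j) xor δ i j) xor (a ∧ b)) (symmetric v i) pivot-row ⟩
    ((E i v ∧ B v j) xor δ i j) xor (E i v ∧ B v j)
      ≡⟨ xor-absorb (E i v ∧ B v j) (δ i j) ⟩
    δ i j ∎
    where
    open ≡-Reasoning
    W′ = remove v W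
    i∈W = ∈-remove⁻ {xs = W} i∈
    j∈W = ∈-remove⁻ {xs = W} j∈
    expand : ∀ l → press E v i l ∧ B l j ≡ (E i l ∧ B l j) xor (E v i ∧ (E v l ∧ B l j))
    expand l = ≡-trans (∧-distribʳ-xor (B l j) (E i l) (E v i ∧ E v l))
                       (cong ((E i l ∧ B l j) xor_) (∧-assoc (E v i) (E v l) (B l j)))
    pivot-row : (E v v ∧ B v j) xor δ v j ≡ B v j
    pivot-row rewrite vv | δ-≢ (≢-sym (∈-remove-≢ {xs = W} j∈)) = xor-identityʳ (B v j)

pressAll-nonsingularOn : ∀ σ {E W B} → Pressable E σ → NonsingularOn E W B →
  NonsingularOn (pressAll E σ) (removeAll σ W) B
pressAll-nonsingularOn []      _        N = N
pressAll-nonsingularOn (v ∷ σ) (vv , p) N = pressAll-nonsingularOn σ p (press-nonsingularOn vv N)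

nonsingularOn-nonempty : ∀ {E B} → NonsingularOn E W B → w ∈ W → ¬ Edgeless E
nonsingularOn-nonempty {W} {w} {E} {B} N w∈ edgeless =
  case ≡-trans (sym (δ-refl w)) (≡-trans (sym (inverse w∈ w∈)) row-sum) of λ ()
  where
  open NonsingularOn N
  row-sum : ⨁ W (λ l → E w l ∧ B l w) ≡ false
  row-sum = ⨁-zero W (λ {l} _ → cong (_∧ B l w) (edgeless w l))

successful-covers : ∀ σ {E W B} → NonsingularOn E W B → Successful E σ → w ∈ W → w ∈ σ
successful-covers {w} σ N s w∈ with w ∈? σ
... | yes w∈σ = w∈σ
... | no  w∉σ = ⊥-elim (nonsingularOn-nonempty
                  (pressAll-nonsingularOn σ (successful⇒pressable σ s) N)
                  (∈-removeAll⁺ σ w∈ w∉σ) (successful⇒edgeless σ s))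

nonsingularOn-diagonal : ∀ {E B} → NonsingularOn E W B → k ∈ W → (∀ w → w ≢ k → E k w ≡ false) →
  E k k ≡ true × B k k ≡ true
nonsingularOn-diagonal {W} {k} {E} {B} N k∈ row = ∧-true (E k k) (begin
  E k k ∧ B k k                                    ≡⟨ xor-identityʳ _ ⟨
  (E k k ∧ B k k) xor false                        ≡⟨ cong ((E k k ∧ B k k) xor_) off-diagonal ⟨
  (E k k ∧ B k k) xor ⨁ (remove k W) (λ l → E k l ∧ B l k)
                                                   ≡⟨ ⨁-remove (λ l → E k l ∧ B l k) unique k∈ ⟨
  ⨁ W (λ l → E k l ∧ B l k)                        ≡⟨ inverse k∈ k∈ ⟩
  δ k k                                            ≡⟨ δ-refl k ⟩
  true                                             ∎)
  where
  open ≡-Reasoning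
  open NonsingularOn N
  off-diagonal : ⨁ (remove k W) (λ l → E k l ∧ B l k) ≡ false
  off-diagonal = ⨁-zero (remove k W) (λ {l} l∈ → cong (_∧ B l k) (row l (∈-remove-≢ {xs = W} l∈)))

transpose : (ℕ → ℕ → Bool) → ℕ → ℕ → Bool
transpose B i j = B j i

-- The Schur complement of B at the pivot B k k, which must be 1.
schur : ℕ → (ℕ → ℕ → Bool) → ℕ → ℕ → Bool
schur k B i j = B i j xor (B i k ∧ B k j)

schur-transpose : ∀ k B i j → schur k (transpose B) i j ≡ transpose (schur k B) i j
schur-transpose k B i j = cong (B j i xor_) (∧-comm (B k i) (B j k))

rightInverseOn-cong : ∀ {E B C} → (∀ i j → B i j ≡ C i j) → RightInverseOn E W B → RightInverseOn E W C
rightInverseOn-cong {W} {E} B≡C inv {i} {j} i∈ j∈ =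
  ≡-trans (⨁-cong W (λ {l} _ → cong (E i l ∧_) (sym (B≡C l j)))) (inv i∈ j∈)

delete-rightInverseOn : ∀ {E B} → Unique W → k ∈ W → B k k ≡ true → RightInverseOn E W B →
  RightInverseOn (delete k E) (remove k W) (schur k B)
delete-rightInverseOn {W} {k} {E} {B} u k∈ kk inv {i} {j} i∈ j∈ = begin
  ⨁ W′ (λ l → delete k E i l ∧ schur k B l j)
    ≡⟨ ⨁-cong W′ (λ {l} l∈ → cong (_∧ schur k B l j) (delete-≢ E i≢k (∈-remove-≢ {xs = W} l∈))) ⟩
  ⨁ W′ (λ l → E i l ∧ (B l j xor (B l k ∧ B k j)))
    ≡⟨ ⨁-cong W′ (λ {l} _ → expand l) ⟩
  ⨁ W′ (λ l → (E i l ∧ B l j) xor ((E i l ∧ B l k) ∧ B k j))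
    ≡⟨ ⨁-xor W′ (λ l → E i l ∧ B l j) (λ l → (E i l ∧ B l k) ∧ B k j) ⟩
  ⨁ W′ (λ l → E i l ∧ B l j) xor ⨁ W′ (λ l → (E i l ∧ B l k) ∧ B k j)
    ≡⟨ cong (⨁ W′ (λ l → E i l ∧ B l j) xor_) (⨁-∧ʳ W′ (λ l → E i l ∧ B l k) (B k j)) ⟩
  ⨁ W′ (λ l → E i l ∧ B l j) xor (⨁ W′ (λ l → E i l ∧ B l k) ∧ B k j)
    ≡⟨ cong₂ (λ s t → s xor (t ∧ B k j)) (rightInverseOn-remove {E = E} {B} u k∈ inv i∈W j∈W)
                                         (rightInverseOn-remove {E = E} {B} u k∈ inv i∈W k∈) ⟩
  ((E i k ∧ B k j) xor δ i j) xor (((E i k ∧ B k k) xor δ i k) ∧ B k j)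
    ≡⟨ cong (λ t → ((E i k ∧ B k j) xor δ i j) xor (t ∧ B k j)) pivot-column ⟩
  ((E i k ∧ B k j) xor δ i j) xor (E i k ∧ B k j)
    ≡⟨ xor-absorb (E i k ∧ B k j) (δ i j) ⟩
  δ i j ∎
  where
  open ≡-Reasoning
  W′ = remove k W
  i∈W = ∈-remove⁻ {xs = W} i∈
  j∈W = ∈-remove⁻ {xs = W} j∈
  i≢k = ∈-remove-≢ {xs = W} i∈
  expand : ∀ l → E i l ∧ (B l j xor (B l k ∧ B k j)) ≡ (E i l ∧ B l j) xor ((E i l ∧ B l k) ∧ B k j)
  expand l = ≡-trans (∧-distribˡ-xor (E i l) (B l j) (B l k ∧ B k j))
                     (cong ((E i l ∧ B l j) xor_) (sym (∧-assoc (E i l) (B l k) (B k j))))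
  pivot-column : (E i k ∧ B k k) xor δ i k ≡ E i k
  pivot-column rewrite kk | δ-≢ i≢k = ≡-trans (xor-identityʳ _) (∧-identityʳ (E i k))

delete-nonsingularOn : ∀ {E B} → k ∈ W → B k k ≡ true → NonsingularOn E W B →
  NonsingularOn (delete k E) (remove k W) (schur k B)
delete-nonsingularOn {k} {W} {E} {B} k∈ kk N = record
  { unique    = UniqP.filter⁺ (λ x → ¬? (x ≟ k)) unique
  ; symmetric = delete-sym symmetric
  ; support   = λ u w uw → let u≢k , _ , uw′ = delete-true E uw in ∈-remove⁺ (support u w uw′) u≢k
  ; inverse   = delete-rightInverseOn {E = E} {B} unique k∈ kk inverse
  }
  where open NonsingularOn N

δ-sym : ∀ a b → δ a b ≡ δ b a
δ-sym a b with a ≟ b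
... | yes refl = refl
... | no  a≢b  = ≡-trans (δ-≢ a≢b) (sym (δ-≢ (≢-sym a≢b)))

lookup-injective : ∀ {xs : List ℕ} → Unique xs → ∀ i j → lookup xs i ≡ lookup xs j → i ≡ j
lookup-injective (_   ∷ _) Fin.zero    Fin.zero    _  = refl
lookup-injective (x∉ ∷ _) Fin.zero    (Fin.suc j) eq = ⊥-elim (All.lookup x∉ (∈-lookup j) eq)
lookup-injective (x∉ ∷ _) (Fin.suc i) Fin.zero    eq = ⊥-elim (All.lookup x∉ (∈-lookup i) (sym eq))
lookup-injective (_   ∷ u) (Fin.suc i) (Fin.suc j) eq = cong Fin.suc (lookup-injective u i j eq)

δ-lookup : ∀ {xs : List ℕ} → Unique xs → ∀ i j → δ (lookup xs i) (lookup xs j) ≡ identity i j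
δ-lookup {xs} u i j with i Fin.≟ j
... | yes refl = δ-refl (lookup xs i)
... | no  i≢j  = δ-≢ (i≢j ∘ lookup-injective u i j)

∀-lookup⇒∀-∈ : ∀ {xs : List ℕ} (P : ℕ → ℕ → Set) → (∀ i j → P (lookup xs i) (lookup xs j)) →
  ∀ {a b} → a ∈ xs → b ∈ xs → P a b
∀-lookup⇒∀-∈ P h a∈ b∈ =
  subst₂ P (sym (lookup-index a∈)) (sym (lookup-index b∈)) (h (Any.index a∈) (Any.index b∈))

atVertices : (xs : List ℕ) → Matrix (length xs) → ℕ → ℕ → Bool
atVertices xs M x y with x ∈? xs | y ∈? xs
... | yes x∈ | yes y∈ = M (Any.index x∈) (Any.index y∈)
... | _      | _      = false

atVertices-lookup : ∀ {xs} (M : Matrix (length xs)) → Unique xs →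
  ∀ i j → atVertices xs M (lookup xs i) (lookup xs j) ≡ M i j
atVertices-lookup {xs} M u i j with lookup xs i ∈? xs | lookup xs j ∈? xs
... | yes i∈ | yes j∈ =
  cong₂ M (lookup-injective u _ _ (sym (lookup-index i∈))) (lookup-injective u _ _ (sym (lookup-index j∈)))
... | no i∉  | _      = ⊥-elim (i∉ (∈-lookup i))
... | yes _  | no j∉  = ⊥-elim (j∉ (∈-lookup j))

fullRank⇒rightInverseOn : ∀ G → FullRank G →
  Σ (ℕ → ℕ → Bool) λ B → RightInverseOn (E G) (V G) B × RightInverseOn (E G) (V G) (transpose B)
fullRank⇒rightInverseOn G (M , AM≡I , MA≡I) = B , inv , invᵀ
  where
  open ≡-Reasoning
  lk = lookup (V G)
  B = atVertices (V G) M
  inv : RightInverseOn (E G) (V G) B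
  inv = ∀-lookup⇒∀-∈ (λ a b → ⨁ (V G) (λ l → E G a l ∧ B l b) ≡ δ a b) λ i j → begin
    ⨁ (V G) (λ l → E G (lk i) l ∧ B l (lk j))       ≡⟨ ⨁-lookup (V G) _ ⟨
    ⨁ (allFin _) (λ l → E G (lk i) (lk l) ∧ B (lk l) (lk j))
      ≡⟨ ⨁-cong (allFin _) (λ {l} _ → cong (E G (lk i) (lk l) ∧_) (atVertices-lookup M (distinct G) l j)) ⟩
    (adjacency G · M) i j                             ≡⟨ AM≡I i j ⟩
    identity i j                                      ≡⟨ δ-lookup (distinct G) i j ⟨
    δ (lk i) (lk j)                                   ∎
  invᵀ : RightInverseOn (E G) (V G) (transpose B)
  invᵀ = ∀-lookup⇒∀-∈ (λ a b → ⨁ (V G) (λ l → E G a l ∧ B b l) ≡ δ a b) λ i j → begin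
    ⨁ (V G) (λ l → E G (lk i) l ∧ B (lk j) l)       ≡⟨ ⨁-lookup (V G) _ ⟨
    ⨁ (allFin _) (λ l → E G (lk i) (lk l) ∧ B (lk j) (lk l))
      ≡⟨ ⨁-cong (allFin _) (λ {l} _ → ≡-trans (∧-comm (E G (lk i) (lk l)) (B (lk j) (lk l)))
           (cong₂ _∧_ (atVertices-lookup M (distinct G) j l) (E-sym G (lk i) (lk l)))) ⟩
    (M · adjacency G) j i                             ≡⟨ MA≡I j i ⟩
    identity j i                                      ≡⟨ δ-lookup (distinct G) j i ⟨
    δ (lk j) (lk i)                                   ≡⟨ δ-sym (lk j) (lk i) ⟩
    δ (lk i) (lk j)                                   ∎

rightInverseOn⇒fullRank : ∀ G {B} → RightInverseOn (E G) (V G) B → RightInverseOn (E G) (V G) (transpose B) →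
  FullRank G
rightInverseOn⇒fullRank G {B} inv invᵀ = M , AM≡I , MA≡I
  where
  open ≡-Reasoning
  lk = lookup (V G)
  M : Matrix (length (V G))
  M i j = B (lk i) (lk j)
  AM≡I : ∀ i j → (adjacency G · M) i j ≡ identity i j
  AM≡I i j = begin
    (adjacency G · M) i j                         ≡⟨ ⨁-lookup (V G) (λ l → E G (lk i) l ∧ B l (lk j)) ⟩
    ⨁ (V G) (λ l → E G (lk i) l ∧ B l (lk j))    ≡⟨ inv (∈-lookup i) (∈-lookup j) ⟩
    δ (lk i) (lk j)                               ≡⟨ δ-lookup (distinct G) i j ⟩
    identity i j                                  ∎
  MA≡I : ∀ i j → (M · adjacency G) i j ≡ identity i j
  MA≡I i j = begin
    (M · adjacency G) i j                         ≡⟨ ⨁-lookup (V G) (λ l → B (lk i) l ∧ E G l (lk j)) ⟩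
    ⨁ (V G) (λ l → B (lk i) l ∧ E G l (lk j))
      ≡⟨ ⨁-cong (V G) (λ {l} _ → ≡-trans (∧-comm (B (lk i) l) (E G l (lk j)))
                                          (cong (_∧ B (lk i) l) (E-sym G l (lk j)))) ⟩
    ⨁ (V G) (λ l → E G (lk j) l ∧ B (lk i) l)    ≡⟨ invᵀ (∈-lookup j) (∈-lookup i) ⟩
    δ (lk j) (lk i)                               ≡⟨ δ-sym (lk j) (lk i) ⟩
    δ (lk i) (lk j)                               ≡⟨ δ-lookup (distinct G) i j ⟩
    identity i j                                  ∎

pressAll-support : ∀ σ {E W B} → NonsingularOn E W B → Pressable E σ →
  pressAll E σ u w ≡ true → u ∈ W × u ∉ σ
pressAll-support σ N p uw = ∈-removeAll⁻ σ (NonsingularOn.support (pressAll-nonsingularOn σ p N) _ _ uw)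

isolatedLoop : ∀ {E} → IsSymmetric E → E k k ≡ true → (∀ w → w ≢ k → E k w ≡ false) → IsolatedLoop E k
isolatedLoop {k} symm loop row =
  record { loop = loop ; row = row ; col = λ u u≢k → ≡-trans (symm u k) (row u u≢k) }

record IsolatedSplit (E : EdgeFn) (σ : List ℕ) (k : ℕ) : Set where
  field
    before after : List ℕ
    split        : σ ≡ before ++ k ∷ after
    isolated     : IsolatedPress E k before after

-- A neighbour w of k at the moment k is pressed would give an arc k → w of D.
minimal-isolatedSplit : ∀ {E B} → NonsingularOn E W B → Successful E σ → k ∈ W →
  (∀ y → y ∈ W → Star (Arc E σ) k y → y ≡ k) → IsolatedSplit E σ k
minimal-isolatedSplit {W} {σ} {k} {E} N σ∈Σ k∈W minimal with ∈-∃++ (successful-covers σ N σ∈Σ k∈W)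
... | pre , post , refl = record
  { before = pre ; after = post ; split = refl
  ; isolated = others , isolatedLoop (pressAll-sym pre (NonsingularOn.symmetric N)) kk row
  }
  where
  others = unique-middle pre (pressable-unique σ (NonsingularOn.symmetric N) (successful⇒pressable σ σ∈Σ))
  p = proj₁ (successful-++⁻ pre σ∈Σ)
  kk = proj₁ (proj₂ (successful-++⁻ pre σ∈Σ))
  row : ∀ w → w ≢ k → pressAll E pre k w ≡ false
  row w w≢k with pressAll E pre k w in kw
  ... | false = refl
  ... | true  = ⊥-elim (w≢k (minimal w w∈W (arc-++⁺ʳ pre (inj₁ (refl , w∈ , kw)) ◅ ε)))
    where
    wk = ≡-trans (pressAll-sym pre (NonsingularOn.symmetric N) w k) kw
    w∈W = proj₁ (pressAll-support pre N p wk)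
    w∈ : w ∈ k ∷ post
    w∈ with ∈-++⁻ pre (successful-covers σ N σ∈Σ w∈W)
    ... | inj₁ w∈pre = ⊥-elim (proj₂ (pressAll-support pre N p wk) w∈pre)
    ... | inj₂ w∈    = w∈

isolatedPress-pivot : ∀ {E B} → NonsingularOn E W B → k ∈ W → Pressable E pre →
  IsolatedPress E k pre post → B k k ≡ true
isolatedPress-pivot {pre = pre} N k∈W p (others , iso) =
  proj₂ (nonsingularOn-diagonal (pressAll-nonsingularOn pre p N) k∈ (IsolatedLoop.row iso))
  where k∈ = ∈-removeAll⁺ pre k∈W (λ k∈pre → All.lookup others (∈-++⁺ˡ k∈pre) refl)

-- The edges left after pressing τ lie on the unpressed vertices, i.e. on k alone;
-- nonsingularity forces the loop.
last-isolatedPress : ∀ {E B} → NonsingularOn E W B → k ∈ W → Pressable E τ → All (_≢ k) τ →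
  (∀ {u} → u ∈ W → u ≢ k → u ∈ τ) → IsolatedPress E k τ []
last-isolatedPress {W} {k} {τ} {E} N k∈W p others covers =
  AllP.++⁺ others [] , isolatedLoop symm (proj₁ (nonsingularOn-diagonal N′ k∈ row)) row
  where
  symm = pressAll-sym τ (NonsingularOn.symmetric N)
  N′ = pressAll-nonsingularOn τ p N
  k∈ = ∈-removeAll⁺ τ k∈W (λ k∈τ → All.lookup others k∈τ refl)
  row : ∀ w → w ≢ k → pressAll E τ k w ≡ false
  row w w≢k with pressAll E τ k w in kw
  ... | false = refl
  ... | true  with pressAll-support τ N p (≡-trans (symm w k) kw)
  ...   | w∈W , w∉τ = ⊥-elim (w∉τ (covers w∈W w≢k))

successful-snoc : ∀ τ {E} → IsolatedPress E k τ [] → Successful E (τ ++ [ k ]) ⇔ Successful (delete k E) τ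
successful-snoc {k} τ {E} ip =
  subst (λ ρ → Successful E (τ ++ [ k ]) ⇔ Successful (delete k E) ρ) (++-identityʳ τ)
    (successful-skip τ ip)

star-snoc : ∀ τ {E} → IsolatedPress E k τ [] → x ≢ k →
  Star (Arc E (τ ++ [ k ])) y x ⇔ Star (Arc (delete k E) τ) y x
star-snoc {k} {x} {y} τ {E} ip x≢k =
  subst (λ ρ → Star (Arc E (τ ++ [ k ])) y x ⇔ Star (Arc (delete k E) ρ) y x) (++-identityʳ τ)
    (star-skip τ ip x≢k , star-unskip τ ip)

module MinimalVertexDeletion (G : OSPGraph) {σ k} (fullRank : FullRank G) (σ∈Σ : InΣ G σ) (k∈V : k ∈ V G)
  (minimal : ∀ y → y ∈ V G → InstrLE G σ y k → y ≡ k) where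

  private
    inverses = fullRank⇒rightInverseOn G fullRank
    B = proj₁ inverses

    N : NonsingularOn (E G) (V G) B
    N = record
      { unique = distinct G ; symmetric = E-sym G ; support = E-inV G ; inverse = proj₁ (proj₂ inverses) }

    minimalSplit : IsolatedSplit (E G) σ k
    minimalSplit = minimal-isolatedSplit N σ∈Σ k∈V minimal

    open IsolatedSplit minimalSplit

    pivot : B k k ≡ true
    pivot = isolatedPress-pivot N k∈V (proj₁ (successful-++⁻ before (subst (InΣ G) split σ∈Σ))) isolated

    N∖k : NonsingularOn (E (G -ᴳ k)) (V (G -ᴳ k)) (schur k B)
    N∖k = delete-nonsingularOn k∈V pivot N

    snoc-isolated : InΣ (G -ᴳ k) τ → IsolatedPress (E G) k τ []
    snoc-isolated {τ} τ∈Σ with pressable-delete⁻ τ (successful⇒pressable τ τ∈Σ)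
    ... | p , others =
      last-isolatedPress N k∈V p others λ u∈V u≢k → successful-covers τ N∖k τ∈Σ (∈-remove⁺ u∈V u≢k)

  fullRank∖k : FullRank (G -ᴳ k)
  fullRank∖k = rightInverseOn⇒fullRank (G -ᴳ k) (NonsingularOn.inverse N∖k)
    (rightInverseOn-cong (schur-transpose k B)
      (delete-rightInverseOn {E = E G} (distinct G) k∈V pivot (proj₂ (proj₂ inverses))))

  σ∖k : List ℕ
  σ∖k = before ++ after

  σ∖k∈Σ : InΣ (G -ᴳ k) σ∖k
  σ∖k∈Σ = proj₁ (successful-skip before isolated) (subst (InΣ G) split σ∈Σ)

  ⪯-delete : x ≢ k → InstrLE G σ x y → InstrLE (G -ᴳ k) σ∖k x y
  ⪯-delete x≢k = star-skip before isolated x≢k ∘ subst (λ ρ → InstrLE G ρ _ _) split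

  ⪯-undelete : InstrLE (G -ᴳ k) σ∖k x y → InstrLE G σ x y
  ⪯-undelete = subst (λ ρ → InstrLE G ρ _ _) (sym split) ∘ star-unskip before isolated

  snoc∈Σ : InΣ (G -ᴳ k) τ → InΣ G (τ ++ [ k ])
  snoc∈Σ {τ} τ∈Σ = proj₂ (successful-snoc τ (snoc-isolated τ∈Σ)) τ∈Σ

  unsnoc∈Σ : τ ↭ remove k (V G) → InΣ G (τ ++ [ k ]) → InΣ (G -ᴳ k) τ
  unsnoc∈Σ {τ} τ↭ τk∈Σ = proj₁ (successful-snoc τ ip) τk∈Σ
    where
    others : All (_≢ k) τ
    others = All.tabulate (λ u∈τ → ∈-remove-≢ {xs = V G} (↭.∈-resp-↭ τ↭ u∈τ))
    ip = last-isolatedPress N k∈V (proj₁ (successful-++⁻ τ τk∈Σ)) others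
           λ u∈V u≢k → ↭.∈-resp-↭ (↭-sym τ↭) (∈-remove⁺ u∈V u≢k)

  ⪯-snoc : InΣ (G -ᴳ k) τ → x ≢ k → InstrLE G (τ ++ [ k ]) x y ⇔ InstrLE (G -ᴳ k) τ x y
  ⪯-snoc {τ} τ∈Σ = star-snoc τ (snoc-isolated τ∈Σ)

∷ʳ-split : ∀ τ pre post → τ ++ [ k ] ≡ pre ++ x ∷ post →
  (x ≡ k × pre ≡ τ) ⊎ ∃ λ post′ → τ ≡ pre ++ x ∷ post′
∷ʳ-split {x = x} τ pre post eq with initLast post
... | []          = let pre≡τ , x≡k = ∷ʳ-injective pre τ (sym eq) in inj₁ (x≡k , pre≡τ)
... | post′ ∷ʳ′ z =
  inj₂ (post′ , ∷ʳ-injectiveˡ τ (pre ++ x ∷ post′) (≡-trans eq (sym (++-assoc pre (x ∷ post′) [ z ]))))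

∷ʳ-↭ : ∀ τ → Unique W → k ∈ W → τ ++ [ k ] ↭ W → τ ↭ remove k W
∷ʳ-↭ {k = k} τ u k∈ τk↭ = ↭.drop-∷ (↭-trans (↭.∷↭∷ʳ k τ) (↭-trans τk↭ (remove-↭ u k∈)))

↭-∷ʳ : ∀ τ → Unique W → k ∈ W → τ ↭ remove k W → τ ++ [ k ] ↭ W
↭-∷ʳ {k = k} τ u k∈ τ↭ = ↭-trans (↭-sym (↭.∷↭∷ʳ k τ)) (↭-trans (↭-prep k τ↭) (↭-sym (remove-↭ u k∈)))

linExt-unsnoc : ∀ {R R′ : Rel} τ → Unique W → k ∈ W → (∀ {x y} → R′ x y → R x y) →
  LinExt W R (τ ++ [ k ]) → LinExt (remove k W) R′ τ
linExt-unsnoc {k = k} τ u k∈ R′⇒R (τk↭ , ordered) =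
  ∷ʳ-↭ τ u k∈ τk↭ ,
  λ pre x post τ≡ y y∈ (yx , y≢x) →
    ordered pre x (post ++ [ k ]) (≡-trans (cong (_++ [ k ]) τ≡) (++-assoc pre (x ∷ post) [ k ]))
      y y∈ (R′⇒R yx , y≢x)

linExt-snoc : ∀ {R R′ : Rel} τ → Unique W → k ∈ W → (∀ y → y ∈ W → R y k → y ≡ k) →
  (∀ {x y} → y ≢ k → R y x → R′ y x) → LinExt (remove k W) R′ τ → LinExt W R (τ ++ [ k ])
linExt-snoc {W} {k} {R} τ u k∈ minimal R⇒R′ (τ↭ , ordered) = ↭-∷ʳ τ u k∈ τ↭ , ordered′
  where
  ordered′ : ∀ pre x post → τ ++ [ k ] ≡ pre ++ x ∷ post → ∀ y → y ∈ pre → ¬ (R y x × y ≢ x)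
  ordered′ pre x post eq y y∈ (yx , y≢x) with ∷ʳ-split τ pre post eq
  ... | inj₁ (refl , refl) = y≢x (minimal y (∈-remove⁻ {xs = W} y∈W∖k) yx)
    where y∈W∖k = ↭.∈-resp-↭ τ↭ y∈
  ... | inj₂ (post′ , τ≡) = ordered pre x post′ τ≡ y y∈ (R⇒R′ (∈-remove-≢ {xs = W} y∈W∖k) yx , y≢x)
    where y∈W∖k = ↭.∈-resp-↭ τ↭ (subst (y ∈_) (sym τ≡) (∈-++⁺ˡ y∈))

module _ {xs ys : List ℕ} {R S : Rel} (iso : OrderIso xs R ys S) where
  open OrderIso iso

  orderIso-minimal : ∀ {k′} → k′ ∈ xs → f k′ ≡ k → (∀ y → y ∈ ys → S y k → y ≡ k) →
    ∀ y → y ∈ xs → R y k′ → y ≡ k′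
  orderIso-minimal k′∈ fk′≡k minimal y y∈ yk′ =
    inj y∈ k′∈ (≡-trans (minimal (f y) (maps y∈) (subst (S (f y)) fk′≡k (proj₁ (pres y∈ k′∈) yk′))) (sym fk′≡k))

  orderIso-remove : ∀ {k′ R′} → k′ ∈ xs → f k′ ≡ k →
    (∀ {x y} → x ∈ remove k′ xs → y ∈ remove k′ xs → R′ x y ⇔ R x y) →
    OrderIso (remove k′ xs) R′ (remove k ys) S
  orderIso-remove {k} {k′} k′∈ fk′≡k R′⇔R = record
    { f    = f
    ; maps = λ x∈ → ∈-remove⁺ (maps (∈xs x∈)) (fx≢k x∈)
    ; inj  = λ x∈ y∈ → inj (∈xs x∈) (∈xs y∈)
    ; surj = surj′
    ; pres = λ x∈ y∈ → ⇔-trans (R′⇔R x∈ y∈) (pres (∈xs x∈) (∈xs y∈))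
    }
    where
    ∈xs : ∀ {x} → x ∈ remove k′ xs → x ∈ xs
    ∈xs = ∈-remove⁻ {xs = xs}
    fx≢k : ∀ {x} → x ∈ remove k′ xs → f x ≢ k
    fx≢k x∈ fx≡k = ∈-remove-≢ {xs = xs} x∈ (inj (∈xs x∈) k′∈ (≡-trans fx≡k (sym fk′≡k)))
    surj′ : ∀ {y} → y ∈ remove k ys → ∃ λ x → x ∈ remove k′ xs × f x ≡ y
    surj′ {y} y∈ with surj (∈-remove⁻ {xs = ys} y∈)
    ... | x , x∈ , fx≡y = x , ∈-remove⁺ x∈ x≢k′ , fx≡y
      where
      x≢k′ : x ≢ k′
      x≢k′ x≡k′ = ∈-remove-≢ {xs = ys} y∈ (≡-trans (sym fx≡y) (≡-trans (cong f x≡k′) fk′≡k))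

remove-cong : (∀ x → x ∈ xs ⇔ x ∈ ys) → ∀ x → x ∈ remove k xs ⇔ x ∈ remove k ys
remove-cong {xs} {ys} xs≡ys x =
  (λ x∈ → ∈-remove⁺ (proj₁ (xs≡ys x) (∈-remove⁻ {xs = xs} x∈)) (∈-remove-≢ {xs = xs} x∈)) ,
  (λ x∈ → ∈-remove⁺ (proj₂ (xs≡ys x) (∈-remove⁻ {xs = ys} x∈)) (∈-remove-≢ {xs = ys} x∈))

autonomous-delete : ∀ {P} → Autonomous P → Minimal P k → Autonomous (P -ᴾ k)
autonomous-delete {k} (G , fullRank , σ , σ∈Σ , iso , Σ⇔LinExt) (k∈P , k-minimal) =
  G -ᴳ k′ , fullRank∖k , σ∖k , σ∖k∈Σ ,
  orderIso-remove iso k′∈V fk′≡k (λ x∈ _ → ⪯-undelete , ⪯-delete (∈-remove-≢ {xs = V G} x∈)) ,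
  Σ∖k⇔LinExt
  where
  open OrderIso iso using (f; surj)
  k′ = proj₁ (surj k∈P)
  k′∈V = proj₁ (proj₂ (surj k∈P))
  fk′≡k = proj₂ (proj₂ (surj k∈P))
  minimal = orderIso-minimal iso k′∈V fk′≡k k-minimal
  open MinimalVertexDeletion G fullRank σ∈Σ k′∈V minimal
  Σ∖k⇔LinExt : ∀ τ → InΣ (G -ᴳ k′) τ ⇔ LinExt (V (G -ᴳ k′)) (InstrLE (G -ᴳ k′) σ∖k) τ
  Σ∖k⇔LinExt τ =
    (λ τ∈Σ → linExt-unsnoc τ (distinct G) k′∈V ⪯-undelete (proj₁ (Σ⇔LinExt (τ ++ [ k′ ])) (snoc∈Σ τ∈Σ))) ,
    (λ ext → unsnoc∈Σ (proj₁ ext) (proj₂ (Σ⇔LinExt (τ ++ [ k′ ])) (linExt-snoc τ (distinct G) k′∈V minimal ⪯-delete ext)))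

singlePoset-delete : ∀ {P} → Minimal P k → (G : OSPGraph) → FullRank G → SinglePoset G P →
  FullRank (G -ᴳ k) × SinglePoset (G -ᴳ k) (P -ᴾ k)
singlePoset-delete {k} {P} (k∈P , k-minimal) G fullRank (P≡V , (σ , σ∈Σ) , Σ-order) =
  fullRank∖k , remove-cong P≡V , (σ∖k , σ∖k∈Σ) , Σ∖k-order
  where
  k∈V = proj₁ (P≡V k) k∈P
  minimal : ∀ y → y ∈ V G → InstrLE G σ y k → y ≡ k
  minimal y y∈V yk = k-minimal y (proj₂ (P≡V y) y∈V) (proj₂ (Σ-order σ σ∈Σ y k y∈V k∈V) yk)
  open MinimalVertexDeletion G fullRank σ∈Σ k∈V minimal
  Σ∖k-order : ∀ τ → InΣ (G -ᴳ k) τ → ∀ x y → x ∈ V (G -ᴳ k) → y ∈ V (G -ᴳ k) →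
    _≼_ P x y ⇔ InstrLE (G -ᴳ k) τ x y
  Σ∖k-order τ τ∈Σ x y x∈ y∈ =
    ⇔-trans (Σ-order (τ ++ [ k ]) (snoc∈Σ τ∈Σ) x y (∈-remove⁻ {xs = V G} x∈) (∈-remove⁻ {xs = V G} y∈))
            (⪯-snoc τ∈Σ (∈-remove-≢ {xs = V G} x∈))

mainTheorem5 : (P : FinPoset) (k : ℕ) → Autonomous P → Minimal P k →
    Autonomous (P -ᴾ k) ×
    ((G : OSPGraph) → FullRank G → SinglePoset G P →
      FullRank (G -ᴳ k) × SinglePoset (G -ᴳ k) (P -ᴾ k))
mainTheorem5 P k autonomous minimal =
  autonomous-delete {k} {P} autonomous minimal , singlePoset-delete {k} {P} minimal
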